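{- Under the $\cdot$ product, $\mathcal F$ is a free algebra on countably many generators. There are two natural sets of generators $\{1,\mathbf d,\mathbf d^{2},\cdots \}$ and $\{1,\mathbf c^{2},\mathbf c^{4},\cdots \}$.
   Context: Let $\mathcal F = k\langle \mathbf c,\mathbf d\rangle$ ($k$ a field of characteristic 0, $\deg\mathbf c=1$, $\deg\mathbf d=2$) and $\hat{\mathcal F}=ke\oplus\mathcal F$ with $e$ a formal symbol of degree $-1$. Define $\Delta$ on $\mathcal F$ by $\Delta(1)=0$, $\Delta(\mathbf c)=2(1\otimes1)$, $\Delta(\mathbf d)=1\otimes\mathbf c+\mathbf c\otimes1$, $\Delta(uv)=\Delta(u)v+u\Delta(v)$ (concatenation product), and $\hat\Delta(e)=e\otimes e$, $\hat\Delta(u)=\Delta(u)+e\otimes u+u\otimes e$. The product $\cdot$ on $\hat{\mathcal F}$ is the transpose of $\hat\Delta$ with respect to the monomial basis: the coefficient of $w$ in $u\cdot v$ equals the coefficient of $u\otimes v$ in $\hat\Delta(w)$; it is associative with unit $e$ and of degree $+1$. Explicitly it is determined by $1\cdot1=2\mathbf c$, $1\cdot\mathbf c=\mathbf c\cdot1=\mathbf d+2\mathbf c^2$, $1\cdot\mathbf d=2\mathbf c\mathbf d$, $\mathbf d\cdot1=2\mathbf d\mathbf c$, $\mathbf c\cdot\mathbf c=\mathbf d\mathbf c+\mathbf c\mathbf d+2\mathbf c^3$, $\mathbf c\cdot\mathbf d=\mathbf d^2+2\mathbf c^2\mathbf d$, $\mathbf d\cdot\mathbf c=\mathbf d^2+2\mathbf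 d\mathbf c^2$, $\mathbf d\cdot\mathbf d=2\mathbf d\mathbf c\mathbf d$, and the rule $(u\epsilon_1)\cdot(\epsilon_2 v)=u(\epsilon_1\cdot\epsilon_2)v$ for letters $\epsilon_1,\epsilon_2\in\{\mathbf c,\mathbf d\}$ and monomials $u,v$. -}

module Defs where

open import Level using (Level; _⊔_) renaming (suc to lsuc)
open import Algebra.Bundles using (CommutativeRing)
open import Data.Nat using (ℕ; zero; suc)
open import Data.Empty using (⊥)
open import Data.Maybe using (Maybe; just; nothing)
import Data.Maybe as Maybe
open import Data.List using (List; []; _∷_; _++_; [_]; concatMap; map; replicate)
open import Data.Product using (_×_; _,_; Σ; ∃; proj₁; proj₂)
open import Relation.Nullary using (¬_; yes; no)
open import Relation.Binary.PropositionalEquality using (_≡_; refl)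
open import Relation.Binary.Definitions using (DecidableEquality)
import Data.List.Properties as ListP
import Data.Product.Properties as ProdP
import Data.Nat.Properties as ℕP

ιR : ∀ {c ℓ} (R : CommutativeRing c ℓ) → ℕ → CommutativeRing.Carrier R
ιR R zero    = CommutativeRing.0# R
ιR R (suc n) = CommutativeRing._+_ R (CommutativeRing.1# R) (ιR R n)

record Char0Field c ℓ : Set (lsuc (c ⊔ ℓ)) where
  field
    commutativeRing : CommutativeRing c ℓ
  open CommutativeRing commutativeRing public
  ι : ℕ → Carrier
  ι = ιR commutativeRing
  field
    1≉0     : ¬ (1# ≈ 0#)
    inverse : ∀ x → ¬ (x ≈ 0#) → Σ Carrier (λ y → (x * y) ≈ 1#)
    char0   : ∀ n → ¬ (ι (suc n) ≈ 0#)

-- Letters c (degree 1), d (degree 2); monomials of 𝓕 = k⟨c,d⟩ are words.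

data Letter : Set where
  𝐜 𝐝 : Letter

_≟L_ : DecidableEquality Letter
𝐜 ≟L 𝐜 = yes refl
𝐜 ≟L 𝐝 = no λ ()
𝐝 ≟L 𝐜 = no λ ()
𝐝 ≟L 𝐝 = yes refl

Word : Set
Word = List Letter

_≟W_ : DecidableEquality Word
_≟W_ = ListP.≡-dec _≟L_

dropLast𝐜 : Word → Maybe Word
dropLast𝐜 []           = nothing
dropLast𝐜 (𝐜 ∷ [])     = just []
dropLast𝐜 (𝐝 ∷ [])     = nothing
dropLast𝐜 (x ∷ y ∷ r)  = Maybe.map (x ∷_) (dropLast𝐜 (y ∷ r))

dropFirst𝐜 : Word → Maybe Word
dropFirst𝐜 (𝐜 ∷ v) = just v
dropFirst𝐜 _       = nothing

module Linear {c ℓ} (K : Char0Field c ℓ) where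
  open Char0Field K

  Lin : Set → Set c
  Lin B = List (Carrier × B)

  coeff : {B : Set} → DecidableEquality B → Lin B → B → Carrier
  coeff _≟_ []             w = 0#
  coeff _≟_ ((a , b) ∷ p)  w with b ≟ w
  ... | yes _ = a + coeff _≟_ p w
  ... | no  _ = coeff _≟_ p w

  Eq : {B : Set} → DecidableEquality B → Lin B → Lin B → Set ℓ
  Eq _≟_ p q = ∀ w → coeff _≟_ p w ≈ coeff _≟_ q w

  -- The product · on 𝓕 (transpose of Δ̂ restricted to 𝓕):
  -- for monomials u, v:
  --   u · v = 2 u c v + [v = c v'] u d v' + [u = u' c] u' d v.
  -- (This reproduces the table 1·1 = 2c, 1·c = d + 2c², …, d·d = 2dcd and
  --  the rule (uε₁)·(ε₂v) = u(ε₁·ε₂)v.)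

  F : Set c
  F = Lin Word

  _≋_ : F → F → Set ℓ
  _≋_ = Eq _≟W_

  mulW : Word → Word → F
  mulW u v =
    (ι 2 , u ++ 𝐜 ∷ v)
    ∷ (term₁ (dropFirst𝐜 v) ++ term₂ (dropLast𝐜 u))
    where
      term₁ : Maybe Word → F
      term₁ (just v') = [ (1# , u ++ 𝐝 ∷ v') ]
      term₁ nothing   = []
      term₂ : Maybe Word → F
      term₂ (just u') = [ (1# , u' ++ 𝐝 ∷ v) ]
      term₂ nothing   = []

  scale : Carrier → F → F
  scale a = map (λ { (b , w) → (a * b , w) })

  _·_ : F → F → F
  p · q = concatMap (λ { (a , u) →
            concatMap (λ { (b , v) → scale (a * b) (mulW u v) }) q }) p

  monomial : Word → F
  monomial w = [ (1# , w) ]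

  -- The free (non-unital, associative) algebra on generators x₀, x₁, …:
  -- its basis is the nonempty words x_{i₀} x_{i₁} ⋯ x_{iₘ}, encoded as
  -- (i₀ , [i₁ , … , iₘ]).

  GenWord : Set
  GenWord = ℕ × List ℕ

  _≟G_ : DecidableEquality GenWord
  _≟G_ = ProdP.≡-dec ℕP._≟_ (ListP.≡-dec ℕP._≟_)

  FreeAlg : Set c
  FreeAlg = Lin GenWord

  _≋G_ : FreeAlg → FreeAlg → Set ℓ
  _≋G_ = Eq _≟G_

  evalGenWord : (ℕ → Word) → ℕ → List ℕ → F
  evalGenWord g i []       = monomial (g i)
  evalGenWord g i (j ∷ js) = monomial (g i) · evalGenWord g j js

  Φ : (ℕ → Word) → FreeAlg → F
  Φ g = concatMap (λ { (a , (i , is)) → scale a (evalGenWord g i is) })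

  IsFreeOn : (ℕ → Word) → Set (c ⊔ ℓ)
  IsFreeOn g =
    (∀ q q' → Φ g q ≋ Φ g q' → q ≋G q')
    × (∀ (p : F) → ∃ λ (q : FreeAlg) → Φ g q ≋ p)

dPowers : ℕ → Word
dPowers i = replicate i 𝐝

c2Powers : ℕ → Word
c2Powers i = replicate (i Data.Nat.* 2) 𝐜

-- Freeness is shown by an explicit inverse Ψ of Φ_g on monomials, obtained by solving the product
-- rule u · v = 2 u𝐜v + [v = 𝐜v'] u𝐝v' + [u = u'𝐜] u'𝐝v for one of its terms:
--   𝐝^a𝐜t     = ½ (𝐝^a · t − [t = 𝐜v'] 𝐝^(a+1)v'),
--   𝐜^(2a+1)t = ½ (𝐜^(2a) · t − [a > 0] 𝐜^(2a−1)𝐝t)     for t not starting with 𝐜,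
--   𝐜^(2a)𝐝v  = 𝐜^(2a) · 𝐜v − 2 𝐜^(2a+2)v − [a > 0] 𝐜^(2a−1)𝐝𝐜v,
-- and replacing each product g_a · w by x_a Ψ(w). Every recursive call lowers the degree or keeps it
-- while shrinking a structural argument. Then Φ(Ψ w) = w, and Ψ(g_a · w) = x_a Ψ(w) gives Ψ(Φ y) = y
-- on the words y of the free algebra. Both maps are graded (x_i has weight 2i) and only finitely many
-- monomials have a given degree, so the linear extension of Ψ is well defined on elements and
-- inverts Φ_g.

module Submission where

open import Defs
open import Function using (_∘_)
open import Data.Nat as ℕ using (ℕ; zero; suc; _≤_; _<_)
import Data.Nat.Properties as ℕ
open import Data.List using (List; []; _∷_; _++_; [_]; map; concatMap; replicate)
import Data.List.Properties as List
open import Data.Maybe using (just; nothing)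
import Data.Maybe as Maybe
open import Data.Product using (_×_; _,_; proj₁; proj₂)
open import Relation.Binary.Bundles using (Setoid)
import Relation.Binary.Reasoning.Setoid
open import Relation.Nullary using (yes; no; contradiction)
open import Relation.Binary.Definitions using (DecidableEquality)
open import Relation.Binary.PropositionalEquality as ≡ using (_≡_; _≢_)

-- Degrees and shapes of words

deg : Word → ℕ
deg []      = 0
deg (𝐜 ∷ w) = suc (deg w)
deg (𝐝 ∷ w) = suc (suc (deg w))

-- the degree of 𝐜^(2a) t and of 𝐝^a t
deg₊ : ℕ → Word → ℕ
deg₊ a t = a ℕ.* 2 ℕ.+ deg t

deg-++ : ∀ u v → deg (u ++ v) ≡ deg u ℕ.+ deg v
deg-++ []      v = ≡.refl
deg-++ (𝐜 ∷ u) v = ≡.cong suc (deg-++ u v)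
deg-++ (𝐝 ∷ u) v = ≡.cong (suc ∘ suc) (deg-++ u v)

deg-replicate-𝐜 : ∀ n → deg (replicate n 𝐜) ≡ n
deg-replicate-𝐜 zero    = ≡.refl
deg-replicate-𝐜 (suc n) = ≡.cong suc (deg-replicate-𝐜 n)

deg-c2Powers-++ : ∀ a t → deg (c2Powers a ++ t) ≡ deg₊ a t
deg-c2Powers-++ a t =
  ≡.trans (deg-++ (c2Powers a) t) (≡.cong (ℕ._+ deg t) (deg-replicate-𝐜 (a ℕ.* 2)))

deg₊-suc : ∀ a t → deg₊ (suc a) t ≡ deg₊ a (𝐜 ∷ 𝐜 ∷ t)
deg₊-suc a t = ≡.sym (≡.trans (ℕ.+-suc (a ℕ.* 2) (suc (deg t))) (≡.cong suc (ℕ.+-suc (a ℕ.* 2) (deg t))))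

deg≡0⇒≡[] : ∀ {w} → deg w ≡ 0 → w ≡ []
deg≡0⇒≡[] {[]}    _  = ≡.refl
deg≡0⇒≡[] {𝐜 ∷ w} ()
deg≡0⇒≡[] {𝐝 ∷ w} ()

deg≡1⇒≡𝐜 : ∀ {w} → deg w ≡ 1 → w ≡ 𝐜 ∷ []
deg≡1⇒≡𝐜 {𝐜 ∷ w} e  = ≡.cong (𝐜 ∷_) (deg≡0⇒≡[] (ℕ.suc-injective e))
deg≡1⇒≡𝐜 {[]}    ()
deg≡1⇒≡𝐜 {𝐝 ∷ w} ()

replicate-++-∷ : ∀ n (x : Letter) w → replicate n x ++ x ∷ w ≡ x ∷ (replicate n x ++ w)
replicate-++-∷ zero    x w = ≡.refl
replicate-++-∷ (suc n) x w = ≡.cong (x ∷_) (replicate-++-∷ n x w)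

dPowers-suc-++ : ∀ a t → dPowers (suc a) ++ t ≡ dPowers a ++ 𝐝 ∷ t
dPowers-suc-++ a t = ≡.sym (replicate-++-∷ a 𝐝 t)

c2Powers-suc-++ : ∀ a t → c2Powers (suc a) ++ t ≡ c2Powers a ++ 𝐜 ∷ 𝐜 ∷ t
c2Powers-suc-++ a t = ≡.sym (≡.trans (replicate-++-∷ (a ℕ.* 2) 𝐜 (𝐜 ∷ t))
                                     (≡.cong (𝐜 ∷_) (replicate-++-∷ (a ℕ.* 2) 𝐜 t)))

dropLast𝐜-dPowers : ∀ a → dropLast𝐜 (dPowers a) ≡ nothing
dropLast𝐜-dPowers zero          = ≡.refl
dropLast𝐜-dPowers (suc zero)    = ≡.refl
dropLast𝐜-dPowers (suc (suc a)) rewrite dropLast𝐜-dPowers (suc a) = ≡.refl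

dropLast𝐜-replicate-𝐜 : ∀ n → dropLast𝐜 (replicate (suc n) 𝐜) ≡ just (replicate n 𝐜)
dropLast𝐜-replicate-𝐜 zero    = ≡.refl
dropLast𝐜-replicate-𝐜 (suc n) rewrite dropLast𝐜-replicate-𝐜 n = ≡.refl

dropFirst𝐜-just : ∀ {w w'} → dropFirst𝐜 w ≡ just w' → w ≡ 𝐜 ∷ w'
dropFirst𝐜-just {𝐜 ∷ w} ≡.refl = ≡.refl

dropLast𝐜-just : ∀ {u u'} → dropLast𝐜 u ≡ just u' → u ≡ u' ++ 𝐜 ∷ []
dropLast𝐜-just-∷ : ∀ x y r {u'} m → dropLast𝐜 (y ∷ r) ≡ m → Maybe.map (x ∷_) m ≡ just u' →
                   x ∷ y ∷ r ≡ u' ++ 𝐜 ∷ []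
dropLast𝐜-just {𝐜 ∷ []}    ≡.refl = ≡.refl
dropLast𝐜-just {𝐜 ∷ y ∷ r} = dropLast𝐜-just-∷ 𝐜 y r (dropLast𝐜 (y ∷ r)) ≡.refl
dropLast𝐜-just {𝐝 ∷ y ∷ r} = dropLast𝐜-just-∷ 𝐝 y r (dropLast𝐜 (y ∷ r)) ≡.refl

dropLast𝐜-just-∷ x y r (just r') e ≡.refl = ≡.cong (x ∷_) (dropLast𝐜-just e)

deg-mulW-middle : ∀ u {w w'} → dropFirst𝐜 w ≡ just w' → deg (u ++ 𝐝 ∷ w') ≡ deg u ℕ.+ suc (deg w)
deg-mulW-middle u {w} e with ≡.refl ← dropFirst𝐜-just {w} e = deg-++ u (𝐝 ∷ _)

deg-mulW-last : ∀ {u u'} w → dropLast𝐜 u ≡ just u' → deg (u' ++ 𝐝 ∷ w) ≡ deg u ℕ.+ suc (deg w)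
deg-mulW-last {u} {u'} w e with ≡.refl ← dropLast𝐜-just {u} e =
  ≡.trans (deg-++ u' (𝐝 ∷ w)) (≡.trans (≡.sym (deg-++ u' (𝐜 ∷ 𝐜 ∷ w)))
    (≡.trans (≡.cong deg (≡.sym (List.++-assoc u' (𝐜 ∷ []) (𝐜 ∷ w)))) (deg-++ (u' ++ 𝐜 ∷ []) (𝐜 ∷ w))))

∸-suc-cancel : ∀ {k} m n → k ≡ m ℕ.+ suc n → n ≡ k ℕ.∸ suc m
∸-suc-cancel m n ≡.refl = ≡.sym (≡.trans (≡.cong (ℕ._∸ suc m) (ℕ.+-suc m n)) (ℕ.m+n∸m≡n m n))

data NoLeading𝐜 : Word → Set where
  nil : NoLeading𝐜 []
  𝐝∷  : ∀ w → NoLeading𝐜 (𝐝 ∷ w)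

wordsOfDegree : ℕ → List Word
wordsOfDegree 0             = [ [] ]
wordsOfDegree 1             = [ 𝐜 ∷ [] ]
wordsOfDegree (suc (suc n)) = map (𝐜 ∷_) (wordsOfDegree (suc n)) ++ map (𝐝 ∷_) (wordsOfDegree n)

module _ {c ℓ} (K : Char0Field c ℓ) where

  open Char0Field K
  open Linear K
  open import Algebra.Properties.Ring ring using (-1*x≈-x; -‿distribʳ-*)
  open import Algebra.Properties.CommutativeSemigroup +-commutativeSemigroup using (interchange)
  open import Algebra.Solver.Ring.NaturalCoefficients.Default commutativeSemiring using (solve; _:+_; _:*_; _:=_)
  module ≈-Reasoning = Relation.Binary.Reasoning.Setoid setoid

  two : Carrier
  two = ι 2

  half : Carrier
  half = proj₁ (inverse two (char0 1))

  two*half≈1 : two * half ≈ 1#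
  two*half≈1 = proj₂ (inverse two (char0 1))

  collapse : ∀ {a b} x y → a ≈ 1# → b ≈ 0# → a * x + b * y ≈ x
  collapse {a} {b} x y a≈1 b≈0 = begin
    a * x + b * y   ≈⟨ +-cong (*-congʳ a≈1) (*-congʳ b≈0) ⟩
    1# * x + 0# * y ≈⟨ +-cong (*-identityˡ x) (zeroˡ y) ⟩
    x + 0#          ≈⟨ +-identityʳ x ⟩
    x               ∎
    where open ≈-Reasoning

  -1*x+x≈0 : ∀ {a} x → a ≈ - 1# → a * x + x ≈ 0#
  -1*x+x≈0 x a≈-1 = trans (+-congʳ (trans (*-congʳ a≈-1) (-1*x≈-x x))) (-‿inverseˡ x)

  halve-≈ : ∀ d t → half * (two * d + t) + (- half) * t ≈ d
  halve-≈ d t = trans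
    (solve 5 (λ h w m d t → h :* (w :* d :+ t) :+ m :* t := (w :* h) :* d :+ (h :+ m) :* t) refl half two (- half) d t)
    (collapse d t two*half≈1 (-‿inverseʳ half))

  double-≈ : ∀ s b → two * (half * s + (- half) * b) + b ≈ s
  double-≈ s b = begin
    two * (half * s + (- half) * b) + b
      ≈⟨ solve 5 (λ h w m s b → w :* (h :* s :+ m :* b) :+ b := (w :* h) :* s :+ ((w :* m) :* b :+ b))
               refl half two (- half) s b ⟩
    (two * half) * s + ((two * - half) * b + b)
      ≈⟨ +-congˡ (-1*x+x≈0 b (trans (sym (-‿distribʳ-* two half)) (-‿cong two*half≈1))) ⟩
    (two * half) * s + 0#                  ≈⟨ +-identityʳ _ ⟩
    (two * half) * s                       ≈⟨ *-congʳ two*half≈1 ⟩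
    1# * s                                 ≈⟨ *-identityˡ s ⟩
    s                                      ∎
    where open ≈-Reasoning

  cancel-≈ : ∀ s x b → s + ((two + - two) * x + ((- 1#) * b + b)) ≈ s
  cancel-≈ s x b = begin
    s + ((two + - two) * x + ((- 1#) * b + b)) ≈⟨ +-congˡ (+-cong (trans (*-congʳ (-‿inverseʳ two)) (zeroˡ x)) (-1*x+x≈0 b refl)) ⟩
    s + (0# + 0#)                              ≈⟨ +-congˡ (+-identityʳ 0#) ⟩
    s + 0#                                     ≈⟨ +-identityʳ s ⟩
    s                                          ∎
    where open ≈-Reasoning

  δ : {B : Set} → DecidableEquality B → B → B → Carrier
  δ _≟_ b w with b ≟ w
  ... | yes _ = 1#
  ... | no  _ = 0#

  δ-≡ : ∀ {B} (_≟_ : DecidableEquality B) {b w} → b ≡ w → δ _≟_ b w ≈ 1#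
  δ-≡ _≟_ {b} {w} b≡w with b ≟ w
  ... | yes _  = refl
  ... | no b≢w = contradiction b≡w b≢w

  δ-≢ : ∀ {B} (_≟_ : DecidableEquality B) {b w} → b ≢ w → δ _≟_ b w ≈ 0#
  δ-≢ _≟_ {b} {w} b≢w with b ≟ w
  ... | yes b≡w = contradiction b≡w b≢w
  ... | no _    = refl

  δ-transport : ∀ {B B'} (_≟_ : DecidableEquality B) (_≟'_ : DecidableEquality B') {b w b' w'} →
                (b ≡ w → b' ≡ w') → (b' ≡ w' → b ≡ w) → δ _≟_ b w ≈ δ _≟'_ b' w'
  δ-transport _≟_ _≟'_ {b} {w} to from with b ≟ w
  ... | yes b≡w = sym (δ-≡ _≟'_ (to b≡w))
  ... | no b≢w  = sym (δ-≢ _≟'_ (b≢w ∘ from))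

  -- Finite sums and formal linear combinations

  ∑ : ∀ {a} {A : Set a} → List A → (A → Carrier) → Carrier
  ∑ []       f = 0#
  ∑ (x ∷ xs) f = f x + ∑ xs f

  infix 5 ∑
  syntax ∑ xs (λ x → e) = ∑[ x ∈ xs ] e

  ∑-cong : ∀ {a} {A : Set a} (xs : List A) {f g : A → Carrier} → (∀ x → f x ≈ g x) → ∑ xs f ≈ ∑ xs g
  ∑-cong []       f≈g = refl
  ∑-cong (x ∷ xs) f≈g = +-cong (f≈g x) (∑-cong xs f≈g)

  ∑-++ : ∀ {a} {A : Set a} (xs ys : List A) f → ∑ (xs ++ ys) f ≈ ∑ xs f + ∑ ys f
  ∑-++ []       ys f = sym (+-identityˡ _)
  ∑-++ (x ∷ xs) ys f = trans (+-congˡ (∑-++ xs ys f)) (sym (+-assoc _ _ _))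

  ∑-map : ∀ {a a'} {A : Set a} {A' : Set a'} (h : A → A') xs (f : A' → Carrier) → ∑ (map h xs) f ≡ ∑ xs (f ∘ h)
  ∑-map h []       f = ≡.refl
  ∑-map h (x ∷ xs) f = ≡.cong (f (h x) +_) (∑-map h xs f)

  ∑-zero : ∀ {a} {A : Set a} (xs : List A) {f : A → Carrier} → (∀ x → f x ≈ 0#) → ∑ xs f ≈ 0#
  ∑-zero []       f≈0 = refl
  ∑-zero (x ∷ xs) f≈0 = trans (+-cong (f≈0 x) (∑-zero xs f≈0)) (+-identityˡ 0#)

  ∑-zeroˡ : ∀ {a} {A : Set a} (xs : List A) {f g : A → Carrier} → (∀ x → f x ≈ 0#) → ∑[ x ∈ xs ] f x * g x ≈ 0#
  ∑-zeroˡ xs {f} {g} f≈0 = ∑-zero xs (λ x → trans (*-congʳ (f≈0 x)) (zeroˡ (g x)))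

  ∑-*ˡ : ∀ {a} {A : Set a} (xs : List A) a f → ∑[ x ∈ xs ] a * f x ≈ a * ∑ xs f
  ∑-*ˡ []       a f = sym (zeroʳ a)
  ∑-*ˡ (x ∷ xs) a f = trans (+-congˡ (∑-*ˡ xs a f)) (sym (distribˡ a _ _))

  ∑-+ : ∀ {a} {A : Set a} (xs : List A) f g → ∑[ x ∈ xs ] (f x + g x) ≈ ∑ xs f + ∑ xs g
  ∑-+ []       f g = sym (+-identityˡ 0#)
  ∑-+ (x ∷ xs) f g = trans (+-congˡ (∑-+ xs f g)) (interchange _ _ _ _)

  ∑-comm : ∀ {a a'} {A : Set a} {A' : Set a'} (xs : List A) (ys : List A') (f : A → A' → Carrier) →
           ∑[ x ∈ xs ] ∑ ys (f x) ≈ ∑[ y ∈ ys ] ∑[ x ∈ xs ] f x y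
  ∑-comm []       ys f = sym (∑-zero ys (λ _ → refl))
  ∑-comm (x ∷ xs) ys f = trans (+-congˡ (∑-comm xs ys f)) (sym (∑-+ ys (f x) _))

  extend : {B : Set} → (B → Carrier) → Lin B → Carrier
  extend h p = ∑ p (λ (a , b) → a * h b)

  sc : {B : Set} → Carrier → Lin B → Lin B
  sc a = map (λ (b , w) → (a * b , w))

  basis : {B : Set} → B → Lin B
  basis b = [ (1# , b) ]

  linExt : {A B : Set} → (A → Lin B) → Lin A → Lin B
  linExt f = concatMap (λ (a , x) → sc a (f x))

  relabel : {A B : Set} → (A → B) → Lin A → Lin B
  relabel f = map (λ (a , x) → (a , f x))

  extend-cong : ∀ {B} {h h' : B → Carrier} p → (∀ b → h b ≈ h' b) → extend h p ≈ extend h' p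
  extend-cong p h≈h' = ∑-cong p (λ (a , b) → *-congˡ (h≈h' b))

  extend-zero : ∀ {B} {h : B → Carrier} p → (∀ b → h b ≈ 0#) → extend h p ≈ 0#
  extend-zero p h≈0 = ∑-zero p (λ (a , b) → trans (*-congˡ (h≈0 b)) (zeroʳ a))

  extend-sc : ∀ {B} (h : B → Carrier) a p → extend h (sc a p) ≈ a * extend h p
  extend-sc h a p = begin
    extend h (sc a p)               ≡⟨ ∑-map _ p _ ⟩
    ∑ p (λ (b , x) → (a * b) * h x)  ≈⟨ ∑-cong p (λ (b , x) → *-assoc a b (h x)) ⟩
    ∑ p (λ (b , x) → a * (b * h x))  ≈⟨ ∑-*ˡ p a _ ⟩
    a * extend h p                  ∎
    where open ≈-Reasoning

  extend-*ʳ : ∀ {B} (h : B → Carrier) x p → extend (λ b → h b * x) p ≈ extend h p * x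
  extend-*ʳ h x p = begin
    extend (λ b → h b * x) p        ≈⟨ ∑-cong p (λ (a , b) → trans (sym (*-assoc a (h b) x)) (*-comm _ x)) ⟩
    ∑ p (λ (a , b) → x * (a * h b))  ≈⟨ ∑-*ˡ p x _ ⟩
    x * extend h p                  ≈⟨ *-comm x _ ⟩
    extend h p * x                  ∎
    where open ≈-Reasoning

  extend-relabel : ∀ {A B} (h : B → Carrier) (f : A → B) p → extend h (relabel f p) ≡ extend (h ∘ f) p
  extend-relabel h f p = ∑-map _ p _

  extend-linExt : ∀ {A B} (h : B → Carrier) (f : A → Lin B) p →
                  extend h (linExt f p) ≈ extend (λ a → extend h (f a)) p
  extend-linExt h f []            = refl
  extend-linExt h f ((a , x) ∷ p) = begin
    extend h (sc a (f x) ++ linExt f p)           ≈⟨ ∑-++ (sc a (f x)) (linExt f p) _ ⟩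
    extend h (sc a (f x)) + extend h (linExt f p) ≈⟨ +-cong (extend-sc h a (f x)) (extend-linExt h f p) ⟩
    a * extend h (f x) + extend (λ a → extend h (f a)) p ∎
    where open ≈-Reasoning

  module Combination {B : Set} (_≟_ : DecidableEquality B) where

    -- Eq _≟_ wrapped in a record, so that Agda can infer the combinations from the goal
    infix 4 _≃_
    record _≃_ (p q : Lin B) : Set ℓ where
      constructor mk≃
      field pointwise : Eq _≟_ p q
    open _≃_ public

    ≃-setoid : Setoid c ℓ
    ≃-setoid = record
      { Carrier       = Lin B
      ; _≈_           = _≃_
      ; isEquivalence = record
        { refl  = mk≃ λ _ → refl
        ; sym   = λ p≃q → mk≃ λ w → sym (pointwise p≃q w)
        ; trans = λ p≃q q≃r → mk≃ λ w → trans (pointwise p≃q w) (pointwise q≃r w)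
        }
      }

    open Setoid ≃-setoid public using () renaming (refl to ≃-refl; sym to ≃-sym; trans to ≃-trans)
    module ≃-Reasoning = Relation.Binary.Reasoning.Setoid ≃-setoid

    ≡⇒≃ : ∀ {p q} → p ≡ q → p ≃ q
    ≡⇒≃ ≡.refl = ≃-refl

    coeff-∷ : ∀ a b p w → coeff _≟_ ((a , b) ∷ p) w ≈ a * δ _≟_ b w + coeff _≟_ p w
    coeff-∷ a b p w with b ≟ w
    ... | yes _ = +-congʳ (sym (*-identityʳ a))
    ... | no  _ = sym (trans (+-congʳ (zeroʳ a)) (+-identityˡ _))

    coeff≈extend : ∀ p w → coeff _≟_ p w ≈ extend (λ b → δ _≟_ b w) p
    coeff≈extend []            w = refl
    coeff≈extend ((a , b) ∷ p) w = trans (coeff-∷ a b p w) (+-congˡ (coeff≈extend p w))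

    coeff-basis : ∀ b w → coeff _≟_ (basis b) w ≈ δ _≟_ b w
    coeff-basis b w = trans (coeff-∷ 1# b [] w) (trans (+-identityʳ _) (*-identityˡ _))

    coeff-++ : ∀ p q w → coeff _≟_ (p ++ q) w ≈ coeff _≟_ p w + coeff _≟_ q w
    coeff-++ p q w = begin
      coeff _≟_ (p ++ q) w                ≈⟨ coeff≈extend (p ++ q) w ⟩
      extend (λ b → δ _≟_ b w) (p ++ q)  ≈⟨ ∑-++ p q _ ⟩
      extend (λ b → δ _≟_ b w) p + extend (λ b → δ _≟_ b w) q ≈⟨ +-cong (coeff≈extend p w) (coeff≈extend q w) ⟨
      coeff _≟_ p w + coeff _≟_ q w       ∎
      where open ≈-Reasoning

    coeff-sc : ∀ a p w → coeff _≟_ (sc a p) w ≈ a * coeff _≟_ p w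
    coeff-sc a p w = begin
      coeff _≟_ (sc a p) w               ≈⟨ coeff≈extend (sc a p) w ⟩
      extend (λ b → δ _≟_ b w) (sc a p) ≈⟨ extend-sc _ a p ⟩
      a * extend (λ b → δ _≟_ b w) p    ≈⟨ *-congˡ (coeff≈extend p w) ⟨
      a * coeff _≟_ p w                  ∎
      where open ≈-Reasoning

    coeff-linExt : ∀ {A} (f : A → Lin B) p w → coeff _≟_ (linExt f p) w ≈ extend (λ a → coeff _≟_ (f a) w) p
    coeff-linExt f p w = begin
      coeff _≟_ (linExt f p) w                          ≈⟨ coeff≈extend (linExt f p) w ⟩
      extend (λ b → δ _≟_ b w) (linExt f p)            ≈⟨ extend-linExt _ f p ⟩
      extend (λ a → extend (λ b → δ _≟_ b w) (f a)) p  ≈⟨ extend-cong p (λ a → coeff≈extend (f a) w) ⟨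
      extend (λ a → coeff _≟_ (f a) w) p               ∎
      where open ≈-Reasoning

    ++-cong : ∀ {p p' q q'} → p ≃ p' → q ≃ q' → p ++ q ≃ p' ++ q'
    ++-cong {p} {p'} {q} {q'} p≃p' q≃q' = mk≃ λ w → begin
      coeff _≟_ (p ++ q) w              ≈⟨ coeff-++ p q w ⟩
      coeff _≟_ p w + coeff _≟_ q w     ≈⟨ +-cong (pointwise p≃p' w) (pointwise q≃q' w) ⟩
      coeff _≟_ p' w + coeff _≟_ q' w   ≈⟨ coeff-++ p' q' w ⟨
      coeff _≟_ (p' ++ q') w            ∎
      where open ≈-Reasoning

    sc-cong : ∀ a {p p'} → p ≃ p' → sc a p ≃ sc a p'
    sc-cong a {p} {p'} p≃p' = mk≃ λ w →
      trans (coeff-sc a p w) (trans (*-congˡ (pointwise p≃p' w)) (sym (coeff-sc a p' w)))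

    concatMap-cong : ∀ {A : Set c} {g g' : A → Lin B} xs → (∀ x → g x ≃ g' x) → concatMap g xs ≃ concatMap g' xs
    concatMap-cong []       g≃g' = ≃-refl
    concatMap-cong (x ∷ xs) g≃g' = ++-cong (g≃g' x) (concatMap-cong xs g≃g')

    linExt-cong : ∀ {A} {f f' : A → Lin B} p → (∀ a → f a ≃ f' a) → linExt f p ≃ linExt f' p
    linExt-cong p f≃f' = concatMap-cong p (λ (a , x) → sc-cong a (f≃f' x))

    linExt-++ : ∀ {A} (f : A → Lin B) p q → linExt f (p ++ q) ≡ linExt f p ++ linExt f q
    linExt-++ f = List.concatMap-++ _

    linExt-sc : ∀ {A} (f : A → Lin B) a p → linExt f (sc a p) ≃ sc a (linExt f p)
    linExt-sc f a p = mk≃ λ w → begin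
      coeff _≟_ (linExt f (sc a p)) w              ≈⟨ coeff-linExt f (sc a p) w ⟩
      extend (λ x → coeff _≟_ (f x) w) (sc a p)   ≈⟨ extend-sc _ a p ⟩
      a * extend (λ x → coeff _≟_ (f x) w) p      ≈⟨ *-congˡ (coeff-linExt f p w) ⟨
      a * coeff _≟_ (linExt f p) w                 ≈⟨ coeff-sc a (linExt f p) w ⟨
      coeff _≟_ (sc a (linExt f p)) w              ∎
      where open ≈-Reasoning

    sc-assoc : ∀ a b p → sc (a * b) p ≃ sc a (sc b p)
    sc-assoc a b p = mk≃ λ w → begin
      coeff _≟_ (sc (a * b) p) w     ≈⟨ coeff-sc (a * b) p w ⟩
      (a * b) * coeff _≟_ p w        ≈⟨ *-assoc a b _ ⟩
      a * (b * coeff _≟_ p w)        ≈⟨ *-congˡ (coeff-sc b p w) ⟨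
      a * coeff _≟_ (sc b p) w       ≈⟨ coeff-sc a (sc b p) w ⟨
      coeff _≟_ (sc a (sc b p)) w    ∎
      where open ≈-Reasoning

    concatMap-scaled : ∀ {A} a (f : A → Lin B) p → concatMap (λ (b , x) → sc (a * b) (f x)) p ≃ sc a (linExt f p)
    concatMap-scaled a f []            = ≃-refl
    concatMap-scaled a f ((b , x) ∷ p) = begin
      sc (a * b) (f x) ++ concatMap (λ (b , x) → sc (a * b) (f x)) p ≈⟨ ++-cong (sc-assoc a b (f x)) (concatMap-scaled a f p) ⟩
      sc a (sc b (f x)) ++ sc a (linExt f p)                         ≡⟨ List.map-++ _ (sc b (f x)) (linExt f p) ⟨
      sc a (linExt f ((b , x) ∷ p))                                  ∎
      where open ≃-Reasoning

    linExt-∘ : ∀ {A A'} (f : A' → Lin B) (h : A → Lin A') p → linExt f (linExt h p) ≃ linExt (linExt f ∘ h) p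
    linExt-∘ f h p = mk≃ λ w → begin
      coeff _≟_ (linExt f (linExt h p)) w                         ≈⟨ coeff-linExt f (linExt h p) w ⟩
      extend (λ x → coeff _≟_ (f x) w) (linExt h p)              ≈⟨ extend-linExt _ h p ⟩
      extend (λ a → extend (λ x → coeff _≟_ (f x) w) (h a)) p    ≈⟨ extend-cong p (λ a → coeff-linExt f (h a) w) ⟨
      extend (λ a → coeff _≟_ (linExt f (h a)) w) p              ≈⟨ coeff-linExt (linExt f ∘ h) p w ⟨
      coeff _≟_ (linExt (linExt f ∘ h) p) w                       ∎
      where open ≈-Reasoning

    linExt-basis : ∀ {A} (f : A → Lin B) a → linExt f (basis a) ≃ f a
    linExt-basis f a = mk≃ λ w → trans (coeff-linExt f (basis a) w) (trans (+-identityʳ _) (*-identityˡ _))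

    linExt-basis-id : ∀ p → linExt basis p ≃ p
    linExt-basis-id p = mk≃ λ w → begin
      coeff _≟_ (linExt basis p) w                 ≈⟨ coeff-linExt basis p w ⟩
      extend (λ b → coeff _≟_ (basis b) w) p     ≈⟨ extend-cong p (λ b → coeff-basis b w) ⟩
      extend (λ b → δ _≟_ b w) p                 ≈⟨ coeff≈extend p w ⟨
      coeff _≟_ p w                               ∎
      where open ≈-Reasoning

    SupportedOn : List B → (B → Carrier) → Set ℓ
    SupportedOn E h = ∀ b → ∑[ e ∈ E ] δ _≟_ b e * h e ≈ h b

    supportedOn-[_] : ∀ w {h} → (∀ b → b ≢ w → h b ≈ 0#) → SupportedOn [ w ] h
    supportedOn-[ w ] {h} h≈0 b with b ≟ w
    ... | yes ≡.refl = trans (+-identityʳ _) (*-identityˡ _)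
    ... | no b≢w     = trans (+-identityʳ _) (trans (zeroˡ (h w)) (sym (h≈0 b b≢w)))

    extend-via-coeff : ∀ {E h} → SupportedOn E h → ∀ p → extend h p ≈ ∑[ e ∈ E ] coeff _≟_ p e * h e
    extend-via-coeff {E} {h} supp p = begin
      extend h p                                                    ≈⟨ extend-cong p (sym ∘ supp) ⟩
      ∑ p (λ (a , b) → a * (∑[ e ∈ E ] δ _≟_ b e * h e))           ≈⟨ ∑-cong p (λ (a , b) → ∑-*ˡ E a _) ⟨
      ∑ p (λ (a , b) → ∑[ e ∈ E ] a * (δ _≟_ b e * h e))           ≈⟨ ∑-comm p E _ ⟩
      ∑[ e ∈ E ] extend (λ b → δ _≟_ b e * h e) p                 ≈⟨ ∑-cong E (λ e → extend-*ʳ _ (h e) p) ⟩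
      ∑[ e ∈ E ] extend (λ b → δ _≟_ b e) p * h e                 ≈⟨ ∑-cong E (λ e → *-congʳ (coeff≈extend p e)) ⟨
      ∑[ e ∈ E ] coeff _≟_ p e * h e                               ∎
      where open ≈-Reasoning

    extend-resp-≃ : ∀ {E h} → SupportedOn E h → ∀ {p p'} → p ≃ p' → extend h p ≈ extend h p'
    extend-resp-≃ {E} supp {p} {p'} p≃p' =
      trans (extend-via-coeff {E} supp p)
            (trans (∑-cong E (λ e → *-congʳ (pointwise p≃p' e))) (sym (extend-via-coeff {E} supp p')))

    record Homogeneous (D : B → ℕ) (n : ℕ) (p : Lin B) : Set ℓ where
      constructor mkHom
      field vanish : ∀ x → D x ≢ n → coeff _≟_ p x ≈ 0#
    open Homogeneous public

    module _ {D : B → ℕ} where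

      []-homogeneous : ∀ {n} → Homogeneous D n []
      []-homogeneous = mkHom λ _ _ → refl

      ∷-homogeneous : ∀ {n a b p} → D b ≡ n → Homogeneous D n p → Homogeneous D n ((a , b) ∷ p)
      ∷-homogeneous {a = a} {b} {p} Db≡n hom = mkHom λ x Dx≢n → begin
        coeff _≟_ ((a , b) ∷ p) x       ≈⟨ coeff-∷ a b p x ⟩
        a * δ _≟_ b x + coeff _≟_ p x   ≈⟨ +-cong (trans (*-congˡ (δ-≢ _≟_ (λ { ≡.refl → Dx≢n Db≡n }))) (zeroʳ a))
                                                  (vanish hom x Dx≢n) ⟩
        0# + 0#                         ≈⟨ +-identityʳ 0# ⟩
        0#                              ∎
        where open ≈-Reasoning

      ++-homogeneous : ∀ {n p q} → Homogeneous D n p → Homogeneous D n q → Homogeneous D n (p ++ q)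
      ++-homogeneous {p = p} {q} hp hq = mkHom λ x Dx≢n →
        trans (coeff-++ p q x) (trans (+-cong (vanish hp x Dx≢n) (vanish hq x Dx≢n)) (+-identityʳ 0#))

      sc-homogeneous : ∀ {n} a {p} → Homogeneous D n p → Homogeneous D n (sc a p)
      sc-homogeneous a {p} hp = mkHom λ x Dx≢n →
        trans (coeff-sc a p x) (trans (*-congˡ (vanish hp x Dx≢n)) (zeroʳ a))

      homogeneous-≡ : ∀ {n m p} → n ≡ m → Homogeneous D n p → Homogeneous D m p
      homogeneous-≡ ≡.refl hp = hp

    halve : ∀ w T → sc half ((two , w) ∷ T) ++ sc (- half) T ≃ basis w
    halve w T = mk≃ λ x → begin
      coeff _≟_ (sc half ((two , w) ∷ T) ++ sc (- half) T) x
        ≈⟨ trans (coeff-++ (sc half ((two , w) ∷ T)) (sc (- half) T) x)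
                 (+-cong (trans (coeff-sc half ((two , w) ∷ T) x) (*-congˡ (coeff-∷ two w T x))) (coeff-sc (- half) T x)) ⟩
      half * (two * δ _≟_ w x + coeff _≟_ T x) + (- half) * coeff _≟_ T x ≈⟨ halve-≈ _ _ ⟩
      δ _≟_ w x                                                           ≈⟨ coeff-basis w x ⟨
      coeff _≟_ (basis w) x                                               ∎
      where open ≈-Reasoning

    double : ∀ S R → sc two (sc half S ++ sc (- half) R) ++ R ≃ S
    double S R = mk≃ λ x → begin
      coeff _≟_ (sc two (sc half S ++ sc (- half) R) ++ R) x
        ≈⟨ trans (coeff-++ (sc two (sc half S ++ sc (- half) R)) R x)
                 (+-congʳ (trans (coeff-sc two (sc half S ++ sc (- half) R) x)
                   (*-congˡ (trans (coeff-++ (sc half S) (sc (- half) R) x) (+-cong (coeff-sc half S x) (coeff-sc (- half) R x)))))) ⟩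
      two * (half * coeff _≟_ S x + (- half) * coeff _≟_ R x) + coeff _≟_ R x ≈⟨ double-≈ _ _ ⟩
      coeff _≟_ S x ∎
      where open ≈-Reasoning

    cancel : ∀ X S R → sc two X ++ (sc 1# (S ++ (sc (- two) X ++ sc (- 1#) R)) ++ R) ≃ S
    cancel X S R = mk≃ λ x → let χ = coeff _≟_ X x; s = coeff _≟_ S x; r = coeff _≟_ R x in begin
      coeff _≟_ (sc two X ++ (sc 1# (S ++ (sc (- two) X ++ sc (- 1#) R)) ++ R)) x
        ≈⟨ trans (coeff-++ (sc two X) _ x) (+-cong (coeff-sc two X x)
             (trans (coeff-++ (sc 1# (S ++ (sc (- two) X ++ sc (- 1#) R))) R x) (+-congʳ
               (trans (coeff-sc 1# (S ++ (sc (- two) X ++ sc (- 1#) R)) x) (trans (*-identityˡ _)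
                 (trans (coeff-++ S (sc (- two) X ++ sc (- 1#) R) x) (+-congˡ
                 (trans (coeff-++ (sc (- two) X) (sc (- 1#) R) x) (+-cong (coeff-sc (- two) X x) (coeff-sc (- 1#) R x)))))))))) ⟩
      two * χ + ((s + ((- two) * χ + (- 1#) * r)) + r)
        ≈⟨ solve 6 (λ w m₂ m₁ χ s r → w :* χ :+ ((s :+ (m₂ :* χ :+ m₁ :* r)) :+ r)
                                       := s :+ ((w :+ m₂) :* χ :+ (m₁ :* r :+ r))) refl two (- two) (- 1#) χ s r ⟩
      s + ((two + - two) * χ + ((- 1#) * r + r))  ≈⟨ cancel-≈ s χ r ⟩
      s ∎
      where open ≈-Reasoning

    uncancel : ∀ u w T → ((two , u) ∷ (1# , w) ∷ T) ++ (sc (- two) (basis u) ++ sc (- 1#) T) ≃ basis w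
    uncancel u w T = mk≃ λ x → let du = δ _≟_ u x; dw = δ _≟_ w x; t = coeff _≟_ T x in begin
      coeff _≟_ (((two , u) ∷ (1# , w) ∷ T) ++ (sc (- two) (basis u) ++ sc (- 1#) T)) x
        ≈⟨ trans (coeff-++ ((two , u) ∷ (1# , w) ∷ T) _ x) (+-cong
             (trans (coeff-∷ two u _ x) (+-congˡ (trans (coeff-∷ 1# w T x) (+-congʳ (*-identityˡ _)))))
             (trans (coeff-++ (sc (- two) (basis u)) (sc (- 1#) T) x)
               (+-cong (trans (coeff-sc (- two) (basis u) x) (*-congˡ (coeff-basis u x))) (coeff-sc (- 1#) T x)))) ⟩
      (two * du + (dw + t)) + ((- two) * du + (- 1#) * t)
        ≈⟨ solve 6 (λ w m₂ m₁ du dw t → (w :* du :+ (dw :+ t)) :+ (m₂ :* du :+ m₁ :* t)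
                                         := dw :+ ((w :+ m₂) :* du :+ (m₁ :* t :+ t))) refl two (- two) (- 1#) du dw t ⟩
      dw + ((two + - two) * du + ((- 1#) * t + t))  ≈⟨ cancel-≈ dw du t ⟩
      dw                                            ≈⟨ coeff-basis w x ⟨
      coeff _≟_ (basis w) x ∎
      where open ≈-Reasoning

  module W = Combination _≟W_
  module G = Combination _≟G_

  δ-∷ : ∀ x v e → δ _≟W_ (x ∷ v) (x ∷ e) ≈ δ _≟W_ v e
  δ-∷ x v e = δ-transport _≟W_ _≟W_ List.∷-injectiveʳ (≡.cong (x ∷_))

  δ-[]-∷ : ∀ x e → δ _≟W_ [] (x ∷ e) ≈ 0#
  δ-[]-∷ x e = δ-≢ _≟W_ {[]} {x ∷ e} λ ()

  δ-∷-≢ : ∀ {x y} v e → x ≢ y → δ _≟W_ (x ∷ v) (y ∷ e) ≈ 0#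
  δ-∷-≢ v e x≢y = δ-≢ _≟W_ (x≢y ∘ List.∷-injectiveˡ)

  wordsOfDegree-supported : ∀ n {h : Word → Carrier} → (∀ w → deg w ≢ n → h w ≈ 0#) →
                            W.SupportedOn (wordsOfDegree n) h
  wordsOfDegree-supported 0 h≈0 = W.supportedOn-[ [] ] (λ b b≢[] → h≈0 b (b≢[] ∘ deg≡0⇒≡[]))
  wordsOfDegree-supported 1 h≈0 = W.supportedOn-[ 𝐜 ∷ [] ] (λ b b≢𝐜 → h≈0 b (b≢𝐜 ∘ deg≡1⇒≡𝐜))
  wordsOfDegree-supported (suc (suc n)) {h} h≈0 b = begin
    ∑[ e ∈ map (𝐜 ∷_) Wc ++ map (𝐝 ∷_) Wd ] δ _≟W_ b e * h e
      ≈⟨ ∑-++ (map (𝐜 ∷_) Wc) (map (𝐝 ∷_) Wd) _ ⟩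
    (∑[ e ∈ map (𝐜 ∷_) Wc ] δ _≟W_ b e * h e) + (∑[ e ∈ map (𝐝 ∷_) Wd ] δ _≟W_ b e * h e)
      ≡⟨ ≡.cong₂ _+_ (∑-map (𝐜 ∷_) Wc _) (∑-map (𝐝 ∷_) Wd _) ⟩
    (∑[ e ∈ Wc ] δ _≟W_ b (𝐜 ∷ e) * h (𝐜 ∷ e)) + (∑[ e ∈ Wd ] δ _≟W_ b (𝐝 ∷ e) * h (𝐝 ∷ e))
      ≈⟨ by-first-letter b ⟩
    h b ∎
    where
      open ≈-Reasoning
      Wc = wordsOfDegree (suc n)
      Wd = wordsOfDegree n
      by-first-letter : ∀ b → (∑[ e ∈ Wc ] δ _≟W_ b (𝐜 ∷ e) * h (𝐜 ∷ e)) + (∑[ e ∈ Wd ] δ _≟W_ b (𝐝 ∷ e) * h (𝐝 ∷ e))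
                              ≈ h b
      by-first-letter [] = trans (+-cong (∑-zeroˡ Wc (δ-[]-∷ 𝐜)) (∑-zeroˡ Wd (δ-[]-∷ 𝐝)))
                                 (trans (+-identityʳ 0#) (sym (h≈0 [] λ ())))
      by-first-letter (𝐜 ∷ v) = trans (+-cong
          (trans (∑-cong Wc (λ e → *-congʳ (δ-∷ 𝐜 v e)))
                 (wordsOfDegree-supported (suc n) (λ w ne → h≈0 (𝐜 ∷ w) (ne ∘ ℕ.suc-injective)) v))
          (∑-zeroˡ Wd (λ e → δ-∷-≢ {𝐜} {𝐝} v e λ ()))) (+-identityʳ _)
      by-first-letter (𝐝 ∷ v) = trans (+-cong
          (∑-zeroˡ Wc (λ e → δ-∷-≢ {𝐝} {𝐜} v e λ ()))
          (trans (∑-cong Wd (λ e → *-congʳ (δ-∷ 𝐝 v e)))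
                 (wordsOfDegree-supported n (λ w ne → h≈0 (𝐝 ∷ w) (ne ∘ ℕ.suc-injective ∘ ℕ.suc-injective)) v)))
          (+-identityˡ _)

  -- Combinations are lists rather than finitely supported functions, so a linear extension respects
  -- ≃ only because each functional w ↦ coeff (f w) x is supported on the finitely many words of one degree.
  linExt-resp-≃ : ∀ {B} (_≟_ : DecidableEquality B) (D : B → ℕ) {f : Word → Lin B} →
                  (∀ w x → deg w ≢ D x → coeff _≟_ (f w) x ≈ 0#) →
                  ∀ {p p'} → p W.≃ p' → Combination._≃_ _≟_ (linExt f p) (linExt f p')
  linExt-resp-≃ _≟_ D {f} f-graded {p} {p'} p≃p' = mk≃ λ x → begin
    coeff _≟_ (linExt f p) x              ≈⟨ coeff-linExt f p x ⟩
    extend (λ w → coeff _≟_ (f w) x) p   ≈⟨ W.extend-resp-≃ {wordsOfDegree (D x)} (wordsOfDegree-supported (D x) (λ w → f-graded w x)) p≃p' ⟩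
    extend (λ w → coeff _≟_ (f w) x) p'  ≈⟨ coeff-linExt f p' x ⟨
    coeff _≟_ (linExt f p') x             ∎
    where
      open ≈-Reasoning
      open Combination _≟_ using (mk≃; coeff-linExt)

  -- The product of 𝓕 and the free algebra

  ev : (ℕ → Word) → GenWord → F
  ev g (i , is) = evalGenWord g i is

  ·-bilinear : ∀ p q → p · q W.≃ linExt (λ u → linExt (mulW u) q) p
  ·-bilinear p q = W.concatMap-cong p (λ (a , u) → W.concatMap-scaled a (mulW u) q)

  monomial-· : ∀ u X → monomial u · X W.≃ linExt (mulW u) X
  monomial-· u X = W.≃-trans (·-bilinear (monomial u) X) (W.linExt-basis (λ u → linExt (mulW u) X) u)

  mulW-homogeneous : ∀ u w → W.Homogeneous deg (deg u ℕ.+ suc (deg w)) (mulW u w)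
  mulW-homogeneous u w with dropFirst𝐜 w in first | dropLast𝐜 u in last
  ... | nothing | nothing = W.∷-homogeneous (deg-++ u (𝐜 ∷ w)) W.[]-homogeneous
  ... | just w' | nothing = W.∷-homogeneous (deg-++ u (𝐜 ∷ w))
                              (W.∷-homogeneous (deg-mulW-middle u first) W.[]-homogeneous)
  ... | nothing | just u' = W.∷-homogeneous (deg-++ u (𝐜 ∷ w))
                              (W.∷-homogeneous (deg-mulW-last w last) W.[]-homogeneous)
  ... | just w' | just u' = W.∷-homogeneous (deg-++ u (𝐜 ∷ w))
                              (W.∷-homogeneous (deg-mulW-middle u first)
                                (W.∷-homogeneous (deg-mulW-last w last) W.[]-homogeneous))

  linExt-mulW-resp-≃ : ∀ u {p p'} → p W.≃ p' → linExt (mulW u) p W.≃ linExt (mulW u) p'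
  linExt-mulW-resp-≃ u = linExt-resp-≃ _≟W_ (λ e → deg e ℕ.∸ suc (deg u)) {mulW u}
    (λ w e ne → W.vanish (mulW-homogeneous u w) e (ne ∘ ∸-suc-cancel (deg u) (deg w)))

  infixr 5 _◃_
  _◃_ : ℕ → GenWord → GenWord
  a ◃ (j , js) = a , j ∷ js

  ◃-injective : ∀ a {y y'} → a ◃ y ≡ a ◃ y' → y ≡ y'
  ◃-injective a ≡.refl = ≡.refl

  tailWeight : List ℕ → ℕ
  tailWeight []       = 0
  tailWeight (j ∷ js) = suc (j ℕ.* 2 ℕ.+ tailWeight js)

  weight : GenWord → ℕ
  weight (i , is) = i ℕ.* 2 ℕ.+ tailWeight is

  -- left multiplication by the generator x_a in the free algebra
  star : ℕ → FreeAlg → FreeAlg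
  star a = relabel (a ◃_)

  data ◃-View (a : ℕ) : GenWord → Set where
    hit  : ∀ y → ◃-View a (a ◃ y)
    miss : ∀ {x} → (∀ y → a ◃ y ≢ x) → ◃-View a x

  ◃-view : ∀ a x → ◃-View a x
  ◃-view a (i , [])     = miss λ _ ()
  ◃-view a (i , k ∷ ks) with i ℕ.≟ a
  ... | yes ≡.refl = hit (k , ks)
  ... | no i≢a     = miss λ y e → i≢a (≡.sym (≡.cong proj₁ e))

  coeff-star : ∀ a Y x → coeff _≟G_ (star a Y) x ≈ extend (λ y → δ _≟G_ (a ◃ y) x) Y
  coeff-star a Y x = trans (G.coeff≈extend (star a Y) x) (reflexive (extend-relabel _ (a ◃_) Y))

  coeff-star-◃ : ∀ a Y y → coeff _≟G_ (star a Y) (a ◃ y) ≈ coeff _≟G_ Y y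
  coeff-star-◃ a Y y = begin
    coeff _≟G_ (star a Y) (a ◃ y)            ≈⟨ coeff-star a Y (a ◃ y) ⟩
    extend (λ y' → δ _≟G_ (a ◃ y') (a ◃ y)) Y
      ≈⟨ extend-cong Y (λ y' → δ-transport _≟G_ _≟G_ (◃-injective a) (≡.cong (a ◃_))) ⟩
    extend (λ y' → δ _≟G_ y' y) Y            ≈⟨ G.coeff≈extend Y y ⟨
    coeff _≟G_ Y y                           ∎
    where open ≈-Reasoning

  coeff-star-miss : ∀ a Y {x} → (∀ y → a ◃ y ≢ x) → coeff _≟G_ (star a Y) x ≈ 0#
  coeff-star-miss a Y {x} outside = trans (coeff-star a Y x) (extend-zero Y (λ y → δ-≢ _≟G_ (outside y)))

  star-cong : ∀ a {Y Y'} → Y G.≃ Y' → star a Y G.≃ star a Y'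
  star-cong a {Y} {Y'} Y≃Y' = mk≃ λ x → by-view (◃-view a x)
    where
      open G using (mk≃)
      by-view : ∀ {x} → ◃-View a x → coeff _≟G_ (star a Y) x ≈ coeff _≟G_ (star a Y') x
      by-view (hit y)   = trans (coeff-star-◃ a Y y) (trans (G.pointwise Y≃Y' y) (sym (coeff-star-◃ a Y' y)))
      by-view (miss ∉) = trans (coeff-star-miss a Y ∉) (sym (coeff-star-miss a Y' ∉))

  star-homogeneous : ∀ a {n Y} → G.Homogeneous weight n Y → G.Homogeneous weight (a ℕ.* 2 ℕ.+ suc n) (star a Y)
  star-homogeneous a {n} {Y} hom = G.mkHom λ x → by-view (◃-view a x)
    where
      by-view : ∀ {x} → ◃-View a x → weight x ≢ a ℕ.* 2 ℕ.+ suc n → coeff _≟G_ (star a Y) x ≈ 0#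
      by-view (hit y)   ne = trans (coeff-star-◃ a Y y) (G.vanish hom y (ne ∘ ≡.cong (λ k → a ℕ.* 2 ℕ.+ suc k)))
      by-view (miss ∉) _  = coeff-star-miss a Y ∉

  star-sc : ∀ a b Y → star a (sc b Y) ≡ sc b (star a Y)
  star-sc a b []      = ≡.refl
  star-sc a b (_ ∷ Y) = ≡.cong (_ ∷_) (star-sc a b Y)

  star-linExt : ∀ {A} a (f : A → FreeAlg) p → star a (linExt f p) ≡ linExt (star a ∘ f) p
  star-linExt a f []            = ≡.refl
  star-linExt a f ((b , x) ∷ p) = begin
    star a (sc b (f x) ++ linExt f p)           ≡⟨ List.map-++ _ (sc b (f x)) (linExt f p) ⟩
    star a (sc b (f x)) ++ star a (linExt f p)  ≡⟨ ≡.cong₂ _++_ (star-sc a b (f x)) (star-linExt a f p) ⟩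
    sc b (star a (f x)) ++ linExt (star a ∘ f) p ∎
    where open ≡.≡-Reasoning

  linExt-relabel : ∀ {A A' B} (f : A' → Lin B) (h : A → A') p → linExt f (relabel h p) ≡ linExt (f ∘ h) p
  linExt-relabel f h []            = ≡.refl
  linExt-relabel f h ((a , x) ∷ p) = ≡.cong (sc a (f (h x)) ++_) (linExt-relabel f h p)

  Φ-star : ∀ g a {Y v} → Φ g Y W.≃ monomial v → Φ g (star a Y) W.≃ mulW (g a) v
  Φ-star g a {Y} {v} ΦY≃v = begin
    Φ g (star a Y)                                   ≡⟨ linExt-relabel (ev g) (a ◃_) Y ⟩
    linExt (λ y → monomial (g a) · ev g y) Y         ≈⟨ W.linExt-cong Y (λ y → monomial-· (g a) (ev g y)) ⟩
    linExt (λ y → linExt (mulW (g a)) (ev g y)) Y    ≈⟨ W.linExt-∘ (mulW (g a)) (ev g) Y ⟨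
    linExt (mulW (g a)) (Φ g Y)                      ≈⟨ linExt-mulW-resp-≃ (g a) ΦY≃v ⟩
    linExt (mulW (g a)) (monomial v)                 ≈⟨ W.linExt-basis (mulW (g a)) v ⟩
    mulW (g a) v                                     ∎
    where open W.≃-Reasoning

  Φ-halve : ∀ g a {Y R t w T} → Φ g Y W.≃ monomial t → Φ g R W.≃ T → mulW (g a) t ≡ (two , w) ∷ T →
            Φ g (sc half (star a Y) ++ sc (- half) R) W.≃ monomial w
  Φ-halve g a {Y} {R} {t} {w} {T} ΦY≃t ΦR≃T g·t≡ = begin
    Φ g (sc half (star a Y) ++ sc (- half) R)          ≡⟨ W.linExt-++ (ev g) (sc half (star a Y)) (sc (- half) R) ⟩
    Φ g (sc half (star a Y)) ++ Φ g (sc (- half) R)    ≈⟨ W.++-cong (W.linExt-sc (ev g) half (star a Y))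
                                                                     (W.linExt-sc (ev g) (- half) R) ⟩
    sc half (Φ g (star a Y)) ++ sc (- half) (Φ g R)    ≈⟨ W.++-cong (W.sc-cong half (Φ-star g a {Y} ΦY≃t))
                                                                     (W.sc-cong (- half) ΦR≃T) ⟩
    sc half (mulW (g a) t) ++ sc (- half) T            ≡⟨ ≡.cong (λ m → sc half m ++ sc (- half) T) g·t≡ ⟩
    sc half ((two , w) ∷ T) ++ sc (- half) T           ≈⟨ W.halve w T ⟩
    monomial w                                         ∎
    where open W.≃-Reasoning

  -- A criterion for freeness

  module Inverse (g : ℕ → Word) (Ψ : Word → FreeAlg)
                 (Ψ-homogeneous : ∀ w → G.Homogeneous weight (deg w) (Ψ w)) where

    Ψ̂ : F → FreeAlg
    Ψ̂ = linExt Ψ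

    Ψ̂-resp-≃ : ∀ {p p'} → p W.≃ p' → Ψ̂ p G.≃ Ψ̂ p'
    Ψ̂-resp-≃ = linExt-resp-≃ _≟G_ weight {Ψ} (λ w x ne → G.vanish (Ψ-homogeneous w) x (ne ∘ ≡.sym))

    Ψ̂-ev : (∀ i → Ψ (g i) G.≃ basis (i , [])) → (∀ i v → Ψ̂ (mulW (g i) v) G.≃ star i (Ψ v)) →
           ∀ y → Ψ̂ (ev g y) G.≃ basis y
    Ψ̂-ev Ψ-g Ψ̂-mulW (i , is) = Ψ̂-evalGenWord i is
      where
        Ψ̂-evalGenWord : ∀ i is → Ψ̂ (evalGenWord g i is) G.≃ basis (i , is)
        Ψ̂-evalGenWord i []       = G.≃-trans (G.linExt-basis Ψ (g i)) (Ψ-g i)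
        Ψ̂-evalGenWord i (j ∷ js) = begin
          Ψ̂ (monomial (g i) · E)        ≈⟨ Ψ̂-resp-≃ (monomial-· (g i) E) ⟩
          Ψ̂ (linExt (mulW (g i)) E)     ≈⟨ G.linExt-∘ Ψ (mulW (g i)) E ⟩
          linExt (Ψ̂ ∘ mulW (g i)) E     ≈⟨ G.linExt-cong E (Ψ̂-mulW i) ⟩
          linExt (star i ∘ Ψ) E          ≡⟨ star-linExt i Ψ E ⟨
          star i (Ψ̂ E)                  ≈⟨ star-cong i (Ψ̂-evalGenWord j js) ⟩
          star i (basis (j , js))        ∎
          where
            open G.≃-Reasoning
            E = evalGenWord g j js

    Ψ̂-double : ∀ {u t w T S R} → mulW u t ≡ (two , w) ∷ T → Ψ w G.≃ sc half S ++ sc (- half) R → Ψ̂ T G.≃ R →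
               Ψ̂ (mulW u t) G.≃ S
    Ψ̂-double {u} {t} {w} {T} {S} {R} u·t≡ Ψw≃ Ψ̂T≃R = begin
      Ψ̂ (mulW u t)                                       ≡⟨ ≡.cong Ψ̂ u·t≡ ⟩
      sc two (Ψ w) ++ Ψ̂ T                                ≈⟨ G.++-cong (G.sc-cong two Ψw≃) Ψ̂T≃R ⟩
      sc two (sc half S ++ sc (- half) R) ++ R            ≈⟨ G.double S R ⟩
      S                                                   ∎
      where open G.≃-Reasoning

    isFreeOn : (∀ y → Ψ̂ (ev g y) G.≃ basis y) → (∀ w → Φ g (Ψ w) W.≃ monomial w) → IsFreeOn g
    isFreeOn Ψ̂∘ev≃basis Φ∘Ψ≃monomial = injective , λ p → Ψ̂ p , W.pointwise (Φ-Ψ̂ p)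
      where
        Ψ̂-Φ : ∀ q → Ψ̂ (Φ g q) G.≃ q
        Ψ̂-Φ q = G.≃-trans (G.linExt-∘ Ψ (ev g) q) (G.≃-trans (G.linExt-cong q Ψ̂∘ev≃basis) (G.linExt-basis-id q))

        Φ-Ψ̂ : ∀ p → Φ g (Ψ̂ p) W.≃ p
        Φ-Ψ̂ p = W.≃-trans (W.linExt-∘ (ev g) Ψ p) (W.≃-trans (W.linExt-cong p Φ∘Ψ≃monomial) (W.linExt-basis-id p))

        injective : ∀ q q' → Φ g q ≋ Φ g q' → q ≋G q'
        injective q q' Φq≋Φq' = G.pointwise (begin
          q            ≈⟨ Ψ̂-Φ q ⟨
          Ψ̂ (Φ g q)   ≈⟨ Ψ̂-resp-≃ (W.mk≃ {Φ g q} {Φ g q'} Φq≋Φq') ⟩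
          Ψ̂ (Φ g q')  ≈⟨ Ψ̂-Φ q' ⟩
          q'           ∎)
          where open G.≃-Reasoning

  module DPowers where

    -- the term of u · t coming from the contraction 𝐜𝐜 ↦ 𝐝 at the junction
    fuse : Word → Word → F
    fuse u (𝐜 ∷ v) = monomial (u ++ 𝐝 ∷ v)
    fuse u []      = []
    fuse u (𝐝 ∷ v) = []

    mulW-dPowers : ∀ a t → mulW (dPowers a) t ≡ (two , dPowers a ++ 𝐜 ∷ t) ∷ fuse (dPowers a) t
    mulW-dPowers a []      rewrite dropLast𝐜-dPowers a = ≡.refl
    mulW-dPowers a (𝐜 ∷ v) rewrite dropLast𝐜-dPowers a = ≡.refl
    mulW-dPowers a (𝐝 ∷ v) rewrite dropLast𝐜-dPowers a = ≡.refl

    mutual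
      -- Ψ a t is the preimage of 𝐝^a t, and Ψ-fuse a t that of fuse (𝐝^a) t
      Ψ : ℕ → Word → FreeAlg
      Ψ a []      = basis (a , [])
      Ψ a (𝐝 ∷ t) = Ψ (suc a) t
      Ψ a (𝐜 ∷ t) = sc half (star a (Ψ 0 t)) ++ sc (- half) (Ψ-fuse a t)

      Ψ-fuse : ℕ → Word → FreeAlg
      Ψ-fuse a (𝐜 ∷ v) = Ψ (suc a) v
      Ψ-fuse a []      = []
      Ψ-fuse a (𝐝 ∷ v) = []

    Ψ' : Word → FreeAlg
    Ψ' = Ψ 0

    Ψ-absorb : ∀ a i t → Ψ a (dPowers i ++ t) ≡ Ψ (a ℕ.+ i) t
    Ψ-absorb a zero    t = ≡.cong (λ k → Ψ k t) (≡.sym (ℕ.+-identityʳ a))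
    Ψ-absorb a (suc i) t = ≡.trans (Ψ-absorb (suc a) i t) (≡.cong (λ k → Ψ k t) (≡.sym (ℕ.+-suc a i)))

    mutual
      Ψ-homogeneous : ∀ a t → G.Homogeneous weight (deg₊ a t) (Ψ a t)
      Ψ-homogeneous a []      = G.∷-homogeneous ≡.refl G.[]-homogeneous
      Ψ-homogeneous a (𝐝 ∷ t) = G.homogeneous-≡ (deg₊-suc a t) (Ψ-homogeneous (suc a) t)
      Ψ-homogeneous a (𝐜 ∷ t) = G.++-homogeneous
        (G.sc-homogeneous half (star-homogeneous a (Ψ-homogeneous 0 t)))
        (G.sc-homogeneous (- half) (Ψ-fuse-homogeneous a t))

      Ψ-fuse-homogeneous : ∀ a t → G.Homogeneous weight (deg₊ a (𝐜 ∷ t)) (Ψ-fuse a t)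
      Ψ-fuse-homogeneous a (𝐜 ∷ v) = G.homogeneous-≡ (deg₊-suc a v) (Ψ-homogeneous (suc a) v)
      Ψ-fuse-homogeneous a []      = G.[]-homogeneous
      Ψ-fuse-homogeneous a (𝐝 ∷ v) = G.[]-homogeneous

    open Inverse dPowers Ψ' (Ψ-homogeneous 0)

    mutual
      Φ-Ψ : ∀ a t → Φ dPowers (Ψ a t) W.≃ monomial (dPowers a ++ t)
      Φ-Ψ a []      = W.≃-trans (W.linExt-basis (ev dPowers) (a , []))
                                (W.≡⇒≃ (≡.cong monomial (≡.sym (List.++-identityʳ (dPowers a)))))
      Φ-Ψ a (𝐝 ∷ t) = W.≃-trans (Φ-Ψ (suc a) t) (W.≡⇒≃ (≡.cong monomial (dPowers-suc-++ a t)))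
      Φ-Ψ a (𝐜 ∷ t) = Φ-halve dPowers a {Ψ 0 t} {Ψ-fuse a t} (Φ-Ψ 0 t) (Φ-Ψ-fuse a t) (mulW-dPowers a t)

      Φ-Ψ-fuse : ∀ a t → Φ dPowers (Ψ-fuse a t) W.≃ fuse (dPowers a) t
      Φ-Ψ-fuse a (𝐜 ∷ v) = W.≃-trans (Φ-Ψ (suc a) v) (W.≡⇒≃ (≡.cong monomial (dPowers-suc-++ a v)))
      Φ-Ψ-fuse a []      = W.≃-refl
      Φ-Ψ-fuse a (𝐝 ∷ v) = W.≃-refl

    Ψ-dPowers : ∀ i → Ψ' (dPowers i) G.≃ basis (i , [])
    Ψ-dPowers i = G.≡⇒≃ (≡.trans (≡.cong Ψ' (≡.sym (List.++-identityʳ (dPowers i)))) (Ψ-absorb 0 i []))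

    Ψ̂-fuse : ∀ i t → Ψ̂ (fuse (dPowers i) t) G.≃ Ψ-fuse i t
    Ψ̂-fuse i (𝐜 ∷ v) = G.≃-trans (G.linExt-basis Ψ' (dPowers i ++ 𝐝 ∷ v)) (G.≡⇒≃ (Ψ-absorb 0 i (𝐝 ∷ v)))
    Ψ̂-fuse i []      = G.≃-refl
    Ψ̂-fuse i (𝐝 ∷ v) = G.≃-refl

    Ψ̂-mulW : ∀ i t → Ψ̂ (mulW (dPowers i) t) G.≃ star i (Ψ' t)
    Ψ̂-mulW i t = Ψ̂-double (mulW-dPowers i t) (G.≡⇒≃ (Ψ-absorb 0 i (𝐜 ∷ t))) (Ψ̂-fuse i t)

    free : IsFreeOn dPowers
    free = isFreeOn (Ψ̂-ev Ψ-dPowers Ψ̂-mulW) (Φ-Ψ 0)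

  module C2Powers where

    -- [a > 0] 𝐜^(2a-1) t : the term of 𝐜^(2a) · v coming from the last letter of 𝐜^(2a)
    odd⁻ : ℕ → Word → F
    odd⁻ zero    t = []
    odd⁻ (suc a) t = monomial (c2Powers a ++ 𝐜 ∷ t)

    mulW-c2Powers : ∀ a {t} → NoLeading𝐜 t → mulW (c2Powers a) t ≡ (two , c2Powers a ++ 𝐜 ∷ t) ∷ odd⁻ a (𝐝 ∷ t)
    mulW-c2Powers zero    nil    = ≡.refl
    mulW-c2Powers zero    (𝐝∷ w) = ≡.refl
    mulW-c2Powers (suc a) nil
      rewrite dropLast𝐜-replicate-𝐜 (suc (a ℕ.* 2)) | replicate-++-∷ (a ℕ.* 2) 𝐜 (𝐝 ∷ []) = ≡.refl
    mulW-c2Powers (suc a) (𝐝∷ w)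
      rewrite dropLast𝐜-replicate-𝐜 (suc (a ℕ.* 2)) | replicate-++-∷ (a ℕ.* 2) 𝐜 (𝐝 ∷ 𝐝 ∷ w) = ≡.refl

    mulW-c2Powers-𝐜 : ∀ a v → mulW (c2Powers a) (𝐜 ∷ v) ≡
      (two , c2Powers a ++ 𝐜 ∷ 𝐜 ∷ v) ∷ (1# , c2Powers a ++ 𝐝 ∷ v) ∷ odd⁻ a (𝐝 ∷ 𝐜 ∷ v)
    mulW-c2Powers-𝐜 zero    v = ≡.refl
    mulW-c2Powers-𝐜 (suc a) v
      rewrite dropLast𝐜-replicate-𝐜 (suc (a ℕ.* 2)) | replicate-++-∷ (a ℕ.* 2) 𝐜 (𝐝 ∷ 𝐜 ∷ v) = ≡.refl

    -- Ψ n a t is the preimage of 𝐜^(2a) t, Ψodd n a t that of 𝐜^(2a+1) t (t without leading 𝐜) and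
    -- Ψodd⁻ n a t that of odd⁻ a t. The fuel n > deg₊ a t is only for termination: calls that keep the
    -- fuel shorten t or decrease a.
    mutual
      Ψ : ℕ → ℕ → Word → FreeAlg
      Ψ zero    a t           = []
      Ψ (suc n) a []          = basis (a , [])
      Ψ (suc n) a (𝐜 ∷ [])    = Ψodd n a []
      Ψ (suc n) a (𝐜 ∷ 𝐝 ∷ v) = Ψodd n a (𝐝 ∷ v)
      Ψ (suc n) a (𝐜 ∷ 𝐜 ∷ t) = Ψ (suc n) (suc a) t
      Ψ (suc n) a (𝐝 ∷ v)     =
        star a (Ψ n 0 (𝐜 ∷ v)) ++ (sc (- two) (Ψ (suc n) (suc a) v) ++ sc (- 1#) (Ψodd⁻ n a (𝐝 ∷ 𝐜 ∷ v)))

      Ψodd : ℕ → ℕ → Word → FreeAlg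
      Ψodd n a t = sc half (star a (Ψ n 0 t)) ++ sc (- half) (Ψodd⁻ n a (𝐝 ∷ t))

      Ψodd⁻ : ℕ → ℕ → Word → FreeAlg
      Ψodd⁻ n zero    t = []
      Ψodd⁻ n (suc a) t = Ψodd n a t

    Ψ' : Word → FreeAlg
    Ψ' w = Ψ (suc (deg w)) 0 w

    Ψ-𝐜 : ∀ n a {t} → NoLeading𝐜 t → Ψ (suc n) a (𝐜 ∷ t) ≡ Ψodd n a t
    Ψ-𝐜 n a nil    = ≡.refl
    Ψ-𝐜 n a (𝐝∷ v) = ≡.refl

    Ψ-absorb : ∀ n a i t → Ψ (suc n) a (c2Powers i ++ t) ≡ Ψ (suc n) (a ℕ.+ i) t
    Ψ-absorb n a zero    t = ≡.cong (λ k → Ψ (suc n) k t) (≡.sym (ℕ.+-identityʳ a))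
    Ψ-absorb n a (suc i) t = ≡.trans (Ψ-absorb n (suc a) i t) (≡.cong (λ k → Ψ (suc n) k t) (≡.sym (ℕ.+-suc a i)))

    Ψ'-absorb : ∀ i t → Ψ' (c2Powers i ++ t) ≡ Ψ (suc (deg (c2Powers i ++ t))) i t
    Ψ'-absorb i t = Ψ-absorb _ 0 i t

    fuel-𝐜∷𝐜∷ : ∀ {n} a t → deg₊ a (𝐜 ∷ 𝐜 ∷ t) < n → deg₊ (suc a) t < n
    fuel-𝐜∷𝐜∷ {n} a t = ≡.subst (_< n) (≡.sym (deg₊-suc a t))

    fuel-tail : ∀ {n} a t → deg₊ a (𝐜 ∷ t) ≤ n → deg t < n
    fuel-tail a t = ℕ.≤-trans (ℕ.m≤n+m (suc (deg t)) (a ℕ.* 2))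

    fuel-odd⁻ : ∀ {n} a u → deg₊ (suc a) (𝐜 ∷ u) ≤ n → deg₊ a (𝐜 ∷ 𝐝 ∷ u) ≤ n
    fuel-odd⁻ {n} a u = ≡.subst (_≤ n) (deg₊-suc a (𝐜 ∷ u))

    mutual
      Ψ-homogeneous : ∀ n a t → G.Homogeneous weight (deg₊ a t) (Ψ n a t)
      Ψ-homogeneous zero    a t           = G.[]-homogeneous
      Ψ-homogeneous (suc n) a []          = G.∷-homogeneous ≡.refl G.[]-homogeneous
      Ψ-homogeneous (suc n) a (𝐜 ∷ [])    = Ψodd-homogeneous n a []
      Ψ-homogeneous (suc n) a (𝐜 ∷ 𝐝 ∷ v) = Ψodd-homogeneous n a (𝐝 ∷ v)
      Ψ-homogeneous (suc n) a (𝐜 ∷ 𝐜 ∷ t) = G.homogeneous-≡ (deg₊-suc a t) (Ψ-homogeneous (suc n) (suc a) t)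
      Ψ-homogeneous (suc n) a (𝐝 ∷ v)     = G.++-homogeneous
        (star-homogeneous a (Ψ-homogeneous n 0 (𝐜 ∷ v)))
        (G.++-homogeneous (G.sc-homogeneous (- two) (G.homogeneous-≡ (deg₊-suc a v) (Ψ-homogeneous (suc n) (suc a) v)))
                          (G.sc-homogeneous (- 1#) (Ψodd⁻-homogeneous n a (𝐜 ∷ v))))

      Ψodd-homogeneous : ∀ n a t → G.Homogeneous weight (deg₊ a (𝐜 ∷ t)) (Ψodd n a t)
      Ψodd-homogeneous n a t = G.++-homogeneous
        (G.sc-homogeneous half (star-homogeneous a (Ψ-homogeneous n 0 t)))
        (G.sc-homogeneous (- half) (Ψodd⁻-homogeneous n a t))

      Ψodd⁻-homogeneous : ∀ n a u → G.Homogeneous weight (deg₊ a (𝐜 ∷ u)) (Ψodd⁻ n a (𝐝 ∷ u))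
      Ψodd⁻-homogeneous n zero    u = G.[]-homogeneous
      Ψodd⁻-homogeneous n (suc a) u = G.homogeneous-≡ (≡.sym (deg₊-suc a (𝐜 ∷ u))) (Ψodd-homogeneous n a (𝐝 ∷ u))

    mutual
      Ψ-fuel : ∀ {n m} a t → deg₊ a t < n → deg₊ a t < m → Ψ n a t G.≃ Ψ m a t
      Ψ-fuel {suc n} {suc m} a []          _  _  = G.≃-refl
      Ψ-fuel {suc n} {suc m} a (𝐜 ∷ [])    hₙ hₘ = Ψodd-fuel a [] (ℕ.s≤s⁻¹ hₙ) (ℕ.s≤s⁻¹ hₘ)
      Ψ-fuel {suc n} {suc m} a (𝐜 ∷ 𝐝 ∷ v) hₙ hₘ = Ψodd-fuel a (𝐝 ∷ v) (ℕ.s≤s⁻¹ hₙ) (ℕ.s≤s⁻¹ hₘ)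
      Ψ-fuel {suc n} {suc m} a (𝐜 ∷ 𝐜 ∷ t) hₙ hₘ = Ψ-fuel (suc a) t (fuel-𝐜∷𝐜∷ a t hₙ) (fuel-𝐜∷𝐜∷ a t hₘ)
      Ψ-fuel {suc n} {suc m} a (𝐝 ∷ v)     hₙ hₘ = G.++-cong
        (star-cong a (Ψ-fuel 0 (𝐜 ∷ v) (fuel-tail a (𝐜 ∷ v) (ℕ.s≤s⁻¹ hₙ)) (fuel-tail a (𝐜 ∷ v) (ℕ.s≤s⁻¹ hₘ))))
        (G.++-cong (G.sc-cong (- two) (Ψ-fuel (suc a) v (fuel-𝐜∷𝐜∷ a v hₙ) (fuel-𝐜∷𝐜∷ a v hₘ)))
                   (G.sc-cong (- 1#) (Ψodd⁻-fuel a (𝐜 ∷ v) (ℕ.s≤s⁻¹ hₙ) (ℕ.s≤s⁻¹ hₘ))))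

      Ψodd-fuel : ∀ {n m} a t → deg₊ a (𝐜 ∷ t) ≤ n → deg₊ a (𝐜 ∷ t) ≤ m → Ψodd n a t G.≃ Ψodd m a t
      Ψodd-fuel a t hₙ hₘ = G.++-cong
        (G.sc-cong half (star-cong a (Ψ-fuel 0 t (fuel-tail a t hₙ) (fuel-tail a t hₘ))))
        (G.sc-cong (- half) (Ψodd⁻-fuel a t hₙ hₘ))

      Ψodd⁻-fuel : ∀ {n m} a u → deg₊ a (𝐜 ∷ u) ≤ n → deg₊ a (𝐜 ∷ u) ≤ m →
                   Ψodd⁻ n a (𝐝 ∷ u) G.≃ Ψodd⁻ m a (𝐝 ∷ u)
      Ψodd⁻-fuel zero    u _  _  = G.≃-refl
      Ψodd⁻-fuel (suc a) u hₙ hₘ = Ψodd-fuel a (𝐝 ∷ u) (fuel-odd⁻ a u hₙ) (fuel-odd⁻ a u hₘ)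

    Ψ-canonical : ∀ {n} a t → deg₊ a t < n → Ψ n a t G.≃ Ψ' (c2Powers a ++ t)
    Ψ-canonical a t h = G.≃-trans (Ψ-fuel a t h (ℕ.s≤s (ℕ.≤-reflexive (≡.sym (deg-c2Powers-++ a t)))))
                                  (G.≡⇒≃ (≡.sym (Ψ'-absorb a t)))

    open Inverse c2Powers Ψ' (λ w → Ψ-homogeneous (suc (deg w)) 0 w)

    mutual
      Φ-Ψ : ∀ {n} a t → deg₊ a t < n → Φ c2Powers (Ψ n a t) W.≃ monomial (c2Powers a ++ t)
      Φ-Ψ {suc n} a [] _ = W.≃-trans (W.linExt-basis (ev c2Powers) (a , []))
                                     (W.≡⇒≃ (≡.cong monomial (≡.sym (List.++-identityʳ (c2Powers a)))))
      Φ-Ψ {suc n} a (𝐜 ∷ [])    h = Φ-Ψodd a nil (ℕ.s≤s⁻¹ h)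
      Φ-Ψ {suc n} a (𝐜 ∷ 𝐝 ∷ v) h = Φ-Ψodd a (𝐝∷ v) (ℕ.s≤s⁻¹ h)
      Φ-Ψ {suc n} a (𝐜 ∷ 𝐜 ∷ t) h = W.≃-trans (Φ-Ψ (suc a) t (fuel-𝐜∷𝐜∷ a t h))
                                              (W.≡⇒≃ (≡.cong monomial (c2Powers-suc-++ a t)))
      Φ-Ψ {suc n} a (𝐝 ∷ v)     h = begin
        Φ c2Powers (star a S ++ (sc (- two) X ++ sc (- 1#) R))
          ≡⟨ ≡.trans (W.linExt-++ (ev c2Powers) (star a S) _)
                     (≡.cong (Φ c2Powers (star a S) ++_) (W.linExt-++ (ev c2Powers) (sc (- two) X) (sc (- 1#) R))) ⟩
        Φ c2Powers (star a S) ++ (Φ c2Powers (sc (- two) X) ++ Φ c2Powers (sc (- 1#) R))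
          ≈⟨ W.++-cong (Φ-star c2Powers a {S} (Φ-Ψ 0 (𝐜 ∷ v) (fuel-tail a (𝐜 ∷ v) (ℕ.s≤s⁻¹ h))))
               (W.++-cong (W.≃-trans (W.linExt-sc (ev c2Powers) (- two) X)
                                     (W.sc-cong (- two) (Φ-Ψ (suc a) v (fuel-𝐜∷𝐜∷ a v h))))
                          (W.≃-trans (W.linExt-sc (ev c2Powers) (- 1#) R)
                                     (W.sc-cong (- 1#) (Φ-Ψodd⁻ a (𝐜 ∷ v) (ℕ.s≤s⁻¹ h))))) ⟩
        mulW (c2Powers a) (𝐜 ∷ v) ++ (sc (- two) (monomial (c2Powers (suc a) ++ v)) ++ sc (- 1#) (odd⁻ a (𝐝 ∷ 𝐜 ∷ v)))
          ≡⟨ ≡.cong₂ (λ m u → m ++ (sc (- two) (monomial u) ++ sc (- 1#) (odd⁻ a (𝐝 ∷ 𝐜 ∷ v))))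
                     (mulW-c2Powers-𝐜 a v) (c2Powers-suc-++ a v) ⟩
        ((two , c2Powers a ++ 𝐜 ∷ 𝐜 ∷ v) ∷ (1# , c2Powers a ++ 𝐝 ∷ v) ∷ odd⁻ a (𝐝 ∷ 𝐜 ∷ v))
          ++ (sc (- two) (monomial (c2Powers a ++ 𝐜 ∷ 𝐜 ∷ v)) ++ sc (- 1#) (odd⁻ a (𝐝 ∷ 𝐜 ∷ v)))
          ≈⟨ W.uncancel (c2Powers a ++ 𝐜 ∷ 𝐜 ∷ v) (c2Powers a ++ 𝐝 ∷ v) (odd⁻ a (𝐝 ∷ 𝐜 ∷ v)) ⟩
        monomial (c2Powers a ++ 𝐝 ∷ v) ∎
        where
          open W.≃-Reasoning
          S = Ψ n 0 (𝐜 ∷ v)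
          X = Ψ (suc n) (suc a) v
          R = Ψodd⁻ n a (𝐝 ∷ 𝐜 ∷ v)

      Φ-Ψodd : ∀ {n} a {t} → NoLeading𝐜 t → deg₊ a (𝐜 ∷ t) ≤ n →
               Φ c2Powers (Ψodd n a t) W.≃ monomial (c2Powers a ++ 𝐜 ∷ t)
      Φ-Ψodd {n} a {t} nlc h =
        Φ-halve c2Powers a {Ψ n 0 t} {Ψodd⁻ n a (𝐝 ∷ t)} (Φ-Ψ 0 t (fuel-tail a t h)) (Φ-Ψodd⁻ a t h) (mulW-c2Powers a nlc)

      Φ-Ψodd⁻ : ∀ {n} a u → deg₊ a (𝐜 ∷ u) ≤ n → Φ c2Powers (Ψodd⁻ n a (𝐝 ∷ u)) W.≃ odd⁻ a (𝐝 ∷ u)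
      Φ-Ψodd⁻ zero    u _ = W.≃-refl
      Φ-Ψodd⁻ (suc a) u h = Φ-Ψodd a (𝐝∷ u) (fuel-odd⁻ a u h)

    Ψ̂-odd⁻ : ∀ {n} a u → deg₊ a (𝐜 ∷ u) ≤ n → Ψ̂ (odd⁻ a (𝐝 ∷ u)) G.≃ Ψodd⁻ n a (𝐝 ∷ u)
    Ψ̂-odd⁻ zero    u _ = G.≃-refl
    Ψ̂-odd⁻ (suc a) u h = G.≃-trans (G.linExt-basis Ψ' (c2Powers a ++ 𝐜 ∷ 𝐝 ∷ u))
                                    (G.≃-sym (Ψ-canonical a (𝐜 ∷ 𝐝 ∷ u) (ℕ.s≤s (fuel-odd⁻ a u h))))

    Ψ-c2Powers : ∀ i → Ψ' (c2Powers i) G.≃ basis (i , [])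
    Ψ-c2Powers i = G.≡⇒≃ (≡.trans (≡.cong Ψ' (≡.sym (List.++-identityʳ (c2Powers i)))) (Ψ'-absorb i []))

    Ψ̂-mulW-noLeading : ∀ i {t} → NoLeading𝐜 t → Ψ̂ (mulW (c2Powers i) t) G.≃ star i (Ψ' t)
    Ψ̂-mulW-noLeading i {t} nlc = G.≃-trans
      (Ψ̂-double (mulW-c2Powers i nlc)
        (G.≃-trans (G.≃-sym (Ψ-canonical i (𝐜 ∷ t) (ℕ.n<1+n N))) (G.≡⇒≃ (Ψ-𝐜 N i nlc)))
        (Ψ̂-odd⁻ i t ℕ.≤-refl))
      (star-cong i (Ψ-canonical 0 t (fuel-tail i t ℕ.≤-refl)))
      where N = deg₊ i (𝐜 ∷ t)

    Ψ̂-mulW-𝐜 : ∀ i v → Ψ̂ (mulW (c2Powers i) (𝐜 ∷ v)) G.≃ star i (Ψ' (𝐜 ∷ v))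
    Ψ̂-mulW-𝐜 i v = begin
      Ψ̂ (mulW (c2Powers i) (𝐜 ∷ v))
        ≡⟨ ≡.cong Ψ̂ (mulW-c2Powers-𝐜 i v) ⟩
      sc two (Ψ' (c2Powers i ++ 𝐜 ∷ 𝐜 ∷ v)) ++ (sc 1# (Ψ' (c2Powers i ++ 𝐝 ∷ v)) ++ Ψ̂ (odd⁻ i (𝐝 ∷ 𝐜 ∷ v)))
        ≈⟨ G.++-cong (G.sc-cong two X-canonical)
                     (G.++-cong (G.≡⇒≃ (≡.cong (sc 1#) (Ψ'-absorb i (𝐝 ∷ v)))) (Ψ̂-odd⁻ i (𝐜 ∷ v) N-bound)) ⟩
      sc two X ++ (sc 1# (star i S ++ (sc (- two) X ++ sc (- 1#) R)) ++ R)
        ≈⟨ G.cancel X (star i S) R ⟩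
      star i S
        ≈⟨ star-cong i (Ψ-canonical 0 (𝐜 ∷ v) (fuel-tail i (𝐜 ∷ v) N-bound)) ⟩
      star i (Ψ' (𝐜 ∷ v)) ∎
      where
        open G.≃-Reasoning
        N = deg (c2Powers i ++ 𝐝 ∷ v)
        S = Ψ N 0 (𝐜 ∷ v)
        X = Ψ (suc N) (suc i) v
        R = Ψodd⁻ N i (𝐝 ∷ 𝐜 ∷ v)
        N-bound : deg₊ i (𝐜 ∷ 𝐜 ∷ v) ≤ N
        N-bound = ℕ.≤-reflexive (≡.sym (deg-c2Powers-++ i (𝐝 ∷ v)))
        X-canonical : Ψ' (c2Powers i ++ 𝐜 ∷ 𝐜 ∷ v) G.≃ X
        X-canonical = G.≃-trans (G.≡⇒≃ (≡.cong Ψ' (≡.sym (c2Powers-suc-++ i v))))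
                                (G.≃-sym (Ψ-canonical (suc i) v (fuel-𝐜∷𝐜∷ i v (ℕ.s≤s N-bound))))

    Ψ̂-mulW : ∀ i t → Ψ̂ (mulW (c2Powers i) t) G.≃ star i (Ψ' t)
    Ψ̂-mulW i []      = Ψ̂-mulW-noLeading i nil
    Ψ̂-mulW i (𝐝 ∷ w) = Ψ̂-mulW-noLeading i (𝐝∷ w)
    Ψ̂-mulW i (𝐜 ∷ v) = Ψ̂-mulW-𝐜 i v

    free : IsFreeOn c2Powers
    free = isFreeOn (Ψ̂-ev Ψ-c2Powers Ψ̂-mulW) (λ w → Φ-Ψ 0 w (ℕ.n<1+n (deg w)))

theoremD1 : ∀ {c ℓ} (K : Char0Field c ℓ) →
    Linear.IsFreeOn K dPowers × Linear.IsFreeOn K c2Powers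
theoremD1 K = DPowers.free K , C2Powers.free K
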